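{- Let $T$ be a finite tree and $P=p_0p_1\dots p_k$ a path in $T$ whose interior vertices $p_1,\dots,p_{k-1}$ all have degree two in $T$. Let $B$ be the vertex set of the component of $p_k$ in $T-E(P)$, and suppose $B\neq\{p_k\}$ (i.e. $p_k$ has a neighbour outside $P$). If $k$ is odd, then for every integer $\ell\ge 1$, \[\omega_{\ell}(p_0,T[B\cup P])-\omega_{\ell}(p_0,P)\leq \omega_{\ell-1}(p_k,T[B\cup P])-\omega_{\ell-1}(p_k,P).\]
   Context: For a graph $G$ and a vertex $x$, $\omega_\ell(x,G)$ is the number of walks of length $\ell$ in $G$ starting at $x$ (walks of length $0$ are single vertices). $T[X]$ is the subgraph of $T$ induced by $X$; $P$ is regarded both as a path and as its vertex set. -}

module Defs where

open import Data.Nat using (ℕ; zero; suc; _+_)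
open import Data.Bool using (Bool; true; false; if_then_else_; _∧_)
open import Data.Fin using (Fin; zero; suc; inject₁)
open import Data.List using (List; []; _∷_)
open import Data.Product using (Σ; _×_; _,_; ∃)
open import Data.Sum using (_⊎_)
open import Data.Empty using (⊥)
open import Relation.Nullary using (¬_)
open import Relation.Binary.PropositionalEquality using (_≡_; _≢_)
open import Function.Definitions using (Injective)

record Graph (n : ℕ) : Set where
  field
    adj   : Fin n → Fin n → Bool
    sym   : ∀ u v → adj u v ≡ adj v u
    irrefl : ∀ v → adj v v ≡ false
open Graph public

sumFin : (n : ℕ) → (Fin n → ℕ) → ℕ
sumFin zero    f = 0
sumFin (suc n) f = f zero + sumFin n (λ i → f (suc i))

deg : ∀ {n} → Graph n → Fin n → ℕ
deg {n} G v = sumFin n (λ w → if adj G v w then 1 else 0)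

data WalkR {n : ℕ} (E : Fin n → Fin n → Set) : Fin n → Fin n → List (Fin n) → Set where
  single : ∀ v → WalkR E v v (v ∷ [])
  step   : ∀ {u w v vs} → E u w → WalkR E w v vs → WalkR E u v (u ∷ vs)

Adj : ∀ {n} → Graph n → Fin n → Fin n → Set
Adj G u v = adj G u v ≡ true

Connected : ∀ {n} → Graph n → Set
Connected {n} G = ∀ (u v : Fin n) → ∃ λ vs → WalkR (Adj G) u v vs

record Cycle {n : ℕ} (G : Graph n) : Set where
  field
    len  : ℕ
    c    : Fin (suc (suc (suc len))) → Fin n
    inj  : Injective _≡_ _≡_ c
    cons : ∀ (i : Fin (suc (suc len))) → Adj G (c (inject₁ i)) (c (suc i))
    close : Adj G (c (Data.Fin.fromℕ (suc (suc len)))) (c zero)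

Acyclic : ∀ {n} → Graph n → Set
Acyclic G = ¬ Cycle G

IsTree : ∀ {n} → Graph n → Set
IsTree G = Connected G × Acyclic G

IsPath : ∀ {n} → Graph n → (k : ℕ) → (Fin (suc k) → Fin n) → Set
IsPath G k p = Injective _≡_ _≡_ p × (∀ (i : Fin k) → Adj G (p (inject₁ i)) (p (suc i)))

InPathEdges : ∀ {n} (k : ℕ) → (Fin (suc k) → Fin n) → Fin n → Fin n → Set
InPathEdges k p u v = Σ (Fin k) λ i →
  (u ≡ p (inject₁ i) × v ≡ p (suc i)) ⊎ (v ≡ p (inject₁ i) × u ≡ p (suc i))

AdjMinus : ∀ {n} → Graph n → (k : ℕ) → (Fin (suc k) → Fin n) → Fin n → Fin n → Set
AdjMinus G k p u v = Adj G u v × ¬ InPathEdges k p u v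

InComponent : ∀ {n} → Graph n → (k : ℕ) → (Fin (suc k) → Fin n) → Fin n → Set
InComponent G k p x = ∃ λ vs → WalkR (AdjMinus G k p) (p (Data.Fin.fromℕ k)) x vs

-- number of walks of length ℓ starting at x in the subgraph G[S] induced by
-- the vertex set S (assumes x ∈ S; walks of length 0 are single vertices)
ω : ∀ {n} → Graph n → (S : Fin n → Bool) → ℕ → Fin n → ℕ
ω {n} G S zero    x = if S x then 1 else 0
ω {n} G S (suc ℓ) x = if S x then sumFin n (λ y → if adj G x y ∧ S y then ω G S ℓ y else 0) else 0

module Submission where

-- Write p_j for the j-th path vertex, S = B ∪ P, and for
-- 0 ≤ j ≤ k put D_ℓ(j) = ω_ℓ(p_j, T[S]) − ω_ℓ(p_j, P); in addition let
-- D_ℓ(k+1) = ω_ℓ(y, T[S]) for a neighbour y ≠ p_{k−1} of p_k in B.  Since T is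
-- a tree and the interior path vertices have degree two, the neighbourhoods
-- along the path are rigid, and counting walks by their second vertex gives
--   D_{ℓ+1}(0) = D_ℓ(1),  D_{ℓ+1}(j) = D_ℓ(j−1) + D_ℓ(j+1)  (0 < j < k),
--   D_ℓ(k−1) + D_ℓ(k+1) ≤ D_{ℓ+1}(k),  D_ℓ(k) ≤ D_{ℓ+1}(k+1),
-- with D_0 = 0 on the path and D_0(k+1) ≥ 0.  A purely arithmetic induction on
-- ℓ shows that any such array satisfies D_ℓ(j) ≤ D_ℓ(i) whenever j + i = k + 1
-- and j ≤ i (this is where k odd is used: no index sits exactly in the middle).
-- The theorem is the case (j, i) = (1, k) combined with D_{ℓ+1}(0) = D_ℓ(1).

module Development where

  open import Defs hiding (sym)
  open import Data.Nat using (ℕ; zero; suc; _+_; _*_; _∸_; _≤_; _<_; z≤n; s≤s; _≤?_)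
  import Data.Nat.Properties as ℕP
  open import Data.Integer as ℤ using (ℤ; +_; _-_)
  import Data.Integer.Properties as ℤP
  open import Data.Integer.Tactic.RingSolver using (solve-∀)
  open import Data.Bool using (Bool; true; false; if_then_else_; _∧_; _∨_)
  open import Data.Bool.Properties using (∨-zeroʳ)
  open import Data.Fin using (Fin; zero; suc; inject₁; fromℕ; fromℕ<; toℕ)
  open import Data.Fin.Properties using (_≟_; toℕ-inject₁; toℕ-fromℕ<; toℕ-fromℕ; toℕ<n)
  open import Data.List using (List; []; _∷_; _++_; length; lookup)
  open import Data.List.Properties using (length-++)
  open import Data.List.Membership.Propositional using (_∈_)
  open import Data.List.Membership.Propositional.Properties using (∈-lookup)
  open import Data.List.Relation.Unary.Any using (here; there; any?)
  open import Data.List.Relation.Unary.All as All using ([]; _∷_)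
  open import Data.List.Relation.Unary.All.Properties using (¬Any⇒All¬)
  open import Data.List.Relation.Unary.AllPairs using ([]; _∷_)
  open import Data.List.Relation.Unary.Unique.Propositional using (Unique)
  import Data.List.Relation.Unary.Unique.Propositional.Properties as Unique
  open import Data.Product using (Σ; _×_; _,_; ∃; proj₁; proj₂)
  open import Data.Sum using (_⊎_; inj₁; inj₂; [_,_])
  open import Data.Empty using (⊥; ⊥-elim)
  open import Relation.Nullary using (¬_; yes; no; does)
  open import Relation.Binary.PropositionalEquality
    using (_≡_; _≢_; refl; sym; trans; cong; cong₂; subst; subst₂; module ≡-Reasoning)

  dropAt : ∀ {n} → Fin n → (Fin n → ℕ) → Fin n → ℕ
  dropAt a g y = if does (y ≟ a) then 0 else g y

  dropAt-≢ : ∀ {n} (a : Fin n) g y → y ≢ a → dropAt a g y ≡ g y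
  dropAt-≢ a g y y≢a with y ≟ a
  ... | yes y≡a = ⊥-elim (y≢a y≡a)
  ... | no _ = refl

  sumFin-split : ∀ n (g : Fin n → ℕ) a → sumFin n g ≡ g a + sumFin n (dropAt a g)
  sumFin-split (suc n) g zero = refl
  sumFin-split (suc n) g (suc a) = begin
      g zero + sumFin n (λ i → g (suc i))
    ≡⟨ cong (λ t → g zero + t) (sumFin-split n (λ i → g (suc i)) a) ⟩
      g zero + (g (suc a) + rest)
    ≡⟨ sym (ℕP.+-assoc (g zero) _ _) ⟩
      (g zero + g (suc a)) + rest
    ≡⟨ cong (λ t → t + rest) (ℕP.+-comm (g zero) _) ⟩
      (g (suc a) + g zero) + rest
    ≡⟨ ℕP.+-assoc (g (suc a)) _ _ ⟩
      g (suc a) + (g zero + rest)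
    ∎
    where
    open ≡-Reasoning
    rest = sumFin n (dropAt a (λ i → g (suc i)))

  sumFin-zero : ∀ n (g : Fin n → ℕ) → (∀ i → g i ≡ 0) → sumFin n g ≡ 0
  sumFin-zero zero g g≡0 = refl
  sumFin-zero (suc n) g g≡0 = cong₂ _+_ (g≡0 zero) (sumFin-zero n (λ i → g (suc i)) (λ i → g≡0 (suc i)))

  sumFin-single : ∀ n (g : Fin n → ℕ) a → (∀ y → y ≢ a → g y ≡ 0) → sumFin n g ≡ g a
  sumFin-single n g a vanish = begin
      sumFin n g                     ≡⟨ sumFin-split n g a ⟩
      g a + sumFin n (dropAt a g)    ≡⟨ cong (λ t → g a + t) (sumFin-zero n (dropAt a g) dropped≡0) ⟩
      g a + 0                        ≡⟨ ℕP.+-identityʳ (g a) ⟩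
      g a                            ∎
    where
    open ≡-Reasoning
    dropped≡0 : ∀ y → dropAt a g y ≡ 0
    dropped≡0 y with y ≟ a
    ... | yes _ = refl
    ... | no y≢a = vanish y y≢a

  sumFin-pair : ∀ n (g : Fin n → ℕ) a b → b ≢ a → (∀ y → y ≢ a → y ≢ b → g y ≡ 0) →
                sumFin n g ≡ g a + g b
  sumFin-pair n g a b b≢a vanish = trans (sumFin-split n g a)
    (cong (λ t → g a + t) (trans (sumFin-single n (dropAt a g) b vanish′) (dropAt-≢ a g b b≢a)))
    where
    vanish′ : ∀ y → y ≢ b → dropAt a g y ≡ 0
    vanish′ y y≢b with y ≟ a
    ... | yes _ = refl
    ... | no y≢a = vanish y y≢a y≢b

  sumFin-≥₁ : ∀ n (g : Fin n → ℕ) a → g a ≤ sumFin n g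
  sumFin-≥₁ n g a = subst (g a ≤_) (sym (sumFin-split n g a)) (ℕP.m≤m+n (g a) _)

  sumFin-≥₂ : ∀ n (g : Fin n → ℕ) a b → b ≢ a → g a + g b ≤ sumFin n g
  sumFin-≥₂ n g a b b≢a = subst (g a + g b ≤_) (sym (sumFin-split n g a))
    (ℕP.+-monoʳ-≤ (g a) (subst (_≤ sumFin n (dropAt a g)) (dropAt-≢ a g b b≢a) (sumFin-≥₁ n (dropAt a g) b)))

  sumFin-≥₃ : ∀ n (g : Fin n → ℕ) a b c → b ≢ a → c ≢ a → c ≢ b → g a + (g b + g c) ≤ sumFin n g
  sumFin-≥₃ n g a b c b≢a c≢a c≢b = subst (g a + (g b + g c) ≤_) (sym (sumFin-split n g a))
    (ℕP.+-monoʳ-≤ (g a) (subst₂ (λ u v → u + v ≤ sumFin n (dropAt a g)) (dropAt-≢ a g b b≢a) (dropAt-≢ a g c c≢a)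
      (sumFin-≥₂ n (dropAt a g) b c c≢b)))

  false≢true : false ≢ true
  false≢true ()

  Adj-sym : ∀ {n} (G : Graph n) {u v} → Adj G u v → Adj G v u
  Adj-sym G {u} {v} u~v = trans (Graph.sym G v u) u~v

  Adj-irrefl : ∀ {n} (G : Graph n) {x} → ¬ Adj G x x
  Adj-irrefl G {x} x~x with trans (sym x~x) (irrefl G x)
  ... | ()

  deg-≥3 : ∀ {n} (G : Graph n) x a b c → Adj G x a → Adj G x b → Adj G x c →
           b ≢ a → c ≢ a → c ≢ b → 3 ≤ deg G x
  deg-≥3 {n} G x a b c x~a x~b x~c b≢a c≢a c≢b =
    subst₂ (λ u v → u + v ≤ deg G x) (indicator x~a) (cong₂ _+_ (indicator x~b) (indicator x~c))
      (sumFin-≥₃ n (λ w → if adj G x w then 1 else 0) a b c b≢a c≢a c≢b)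
    where
    indicator : ∀ {y} → Adj G x y → (if adj G x y then 1 else 0) ≡ 1
    indicator x~y rewrite x~y = refl

  module Walks {n : ℕ} {E : Fin n → Fin n → Set} where

    walk-starts : ∀ {u v xs} → WalkR E u v xs → ∃ λ ys → xs ≡ u ∷ ys
    walk-starts (single v) = [] , refl
    walk-starts (step {vs = vs} _ _) = vs , refl

    walk-++ : ∀ {a b c xs ys} → WalkR E a b xs → WalkR E b c (b ∷ ys) → WalkR E a c (xs ++ ys)
    walk-++ (single _) w₂ = w₂
    walk-++ (step e w) w₂ = step e (walk-++ w w₂)

    walk-entered : ∀ {a b xs z} → WalkR E a b xs → z ∈ xs → z ≡ a ⊎ ∃ λ x → E x z
    walk-entered (single _) (here refl) = inj₁ refl
    walk-entered (step e w) (here refl) = inj₁ refl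
    walk-entered (step e w) (there z∈) with walk-entered w z∈
    ... | inj₁ refl = inj₂ (_ , e)
    ... | inj₂ entered = inj₂ entered

    walk-from : ∀ {u w v xs} → WalkR E w v xs → Unique xs → u ∈ xs → ∃ λ ys → WalkR E u v ys × Unique ys
    walk-from (single _) U (here refl) = _ , single _ , U
    walk-from (step e w) U (here refl) = _ , step e w , U
    walk-from (step e w) (_ ∷ U) (there u∈) = walk-from w U u∈

    loop-erase : ∀ {u v xs} → WalkR E u v xs → ∃ λ ys → WalkR E u v ys × Unique ys
    loop-erase (single v) = _ , single v , ([] ∷ [])
    loop-erase {u} (step e w) with loop-erase w
    ... | ys , w′ , U with any? (u ≟_) ys
    ...   | yes u∈ = walk-from w′ U u∈
    ...   | no u∉ = _ , step e w′ , (¬Any⇒All¬ ys u∉ ∷ U)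

    walk-consecutive : ∀ {a b x xs} → WalkR E a b (x ∷ xs) → (i : Fin (length xs)) →
                       E (lookup (x ∷ xs) (inject₁ i)) (lookup (x ∷ xs) (suc i))
    walk-consecutive (step e (single _)) zero = e
    walk-consecutive (step e (step _ _)) zero = e
    walk-consecutive (step _ (step e w)) (suc i) = walk-consecutive (step e w) i

    walk-last : ∀ {a b x xs} → WalkR E a b (x ∷ xs) → lookup (x ∷ xs) (fromℕ (length xs)) ≡ b
    walk-last (single _) = refl
    walk-last (step _ (single _)) = refl
    walk-last (step _ (step e w)) = walk-last (step e w)

    walk-first : ∀ {a b x xs} → WalkR E a b (x ∷ xs) → x ≡ a
    walk-first (single _) = refl
    walk-first (step _ _) = refl

  open Walks

  walk-map : ∀ {n} {E F : Fin n → Fin n → Set} → (∀ {x y} → E x y → F x y) →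
             ∀ {a b xs} → WalkR E a b xs → WalkR F a b xs
  walk-map f (single v) = single v
  walk-map f (step e w) = step (f e) (walk-map f w)

  lookup-injective : ∀ {n} (xs : List (Fin n)) → Unique xs → ∀ i j → lookup xs i ≡ lookup xs j → i ≡ j
  lookup-injective (x ∷ xs) U zero zero eq = refl
  lookup-injective (x ∷ xs) (x∉ ∷ U) zero (suc j) eq = ⊥-elim (All.lookup x∉ (∈-lookup {xs = xs} j) eq)
  lookup-injective (x ∷ xs) (x∉ ∷ U) (suc i) zero eq = ⊥-elim (All.lookup x∉ (∈-lookup {xs = xs} i) (sym eq))
  lookup-injective (x ∷ xs) (_ ∷ U) (suc i) (suc j) eq = cong suc (lookup-injective xs U i j eq)

  closed-walk⇒cycle : ∀ {n} (G : Graph n) {a b cs} → WalkR (Adj G) a b cs → Unique cs →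
                      3 ≤ length cs → Adj G b a → Cycle G
  closed-walk⇒cycle G {cs = c₀ ∷ c₁ ∷ c₂ ∷ rest} W U (s≤s (s≤s (s≤s _))) b~a = record
    { len = length rest
    ; c = lookup (c₀ ∷ c₁ ∷ c₂ ∷ rest)
    ; inj = λ {i} {j} → lookup-injective _ U i j
    ; cons = walk-consecutive W
    ; close = subst₂ (Adj G) (sym (walk-last W)) (sym (walk-first W)) b~a
    }

  -- Counting walks in an induced subgraph G[S] by their second vertex.

  module WalkCount {n : ℕ} (G : Graph n) (S : Fin n → Bool) where

    via : ℕ → Fin n → Fin n → ℕ
    via ℓ x y = if adj G x y ∧ S y then ω G S ℓ y else 0

    via-neighbour : ∀ ℓ x y → Adj G x y → S y ≡ true → via ℓ x y ≡ ω G S ℓ y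
    via-neighbour ℓ x y x~y Sy rewrite x~y | Sy = refl

    via-other : ∀ ℓ x y → (Adj G x y → S y ≡ true → ⊥) → via ℓ x y ≡ 0
    via-other ℓ x y not-nb = vanishes (adj G x y) (S y) not-nb
      where
      vanishes : ∀ (b c : Bool) → (b ≡ true → c ≡ true → ⊥) → (if b ∧ c then ω G S ℓ y else 0) ≡ 0
      vanishes true true not-both = ⊥-elim (not-both refl refl)
      vanishes true false _ = refl
      vanishes false _ _ = refl

    ω-suc : ∀ ℓ x → S x ≡ true → ω G S (suc ℓ) x ≡ sumFin n (via ℓ x)
    ω-suc ℓ x Sx rewrite Sx = refl

    ω-zero : ∀ x → S x ≡ true → ω G S 0 x ≡ 1
    ω-zero x Sx rewrite Sx = refl

    ω-one-neighbour : ∀ ℓ x a → S x ≡ true → S a ≡ true → Adj G x a →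
                      (∀ y → Adj G x y → S y ≡ true → y ≡ a) → ω G S (suc ℓ) x ≡ ω G S ℓ a
    ω-one-neighbour ℓ x a Sx Sa x~a only-a = begin
        ω G S (suc ℓ) x       ≡⟨ ω-suc ℓ x Sx ⟩
        sumFin n (via ℓ x)    ≡⟨ sumFin-single n (via ℓ x) a (λ y y≢a → via-other ℓ x y (λ x~y Sy → y≢a (only-a y x~y Sy))) ⟩
        via ℓ x a             ≡⟨ via-neighbour ℓ x a x~a Sa ⟩
        ω G S ℓ a             ∎
      where open ≡-Reasoning

    ω-two-neighbours : ∀ ℓ x a b → S x ≡ true → S a ≡ true → S b ≡ true → Adj G x a → Adj G x b → b ≢ a →
                       (∀ y → Adj G x y → S y ≡ true → y ≡ a ⊎ y ≡ b) →
                       ω G S (suc ℓ) x ≡ ω G S ℓ a + ω G S ℓ b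
    ω-two-neighbours ℓ x a b Sx Sa Sb x~a x~b b≢a only-ab = begin
        ω G S (suc ℓ) x          ≡⟨ ω-suc ℓ x Sx ⟩
        sumFin n (via ℓ x)       ≡⟨ sumFin-pair n (via ℓ x) a b b≢a vanish ⟩
        via ℓ x a + via ℓ x b    ≡⟨ cong₂ _+_ (via-neighbour ℓ x a x~a Sa) (via-neighbour ℓ x b x~b Sb) ⟩
        ω G S ℓ a + ω G S ℓ b    ∎
      where
      open ≡-Reasoning
      vanish : ∀ y → y ≢ a → y ≢ b → via ℓ x y ≡ 0
      vanish y y≢a y≢b = via-other ℓ x y λ x~y Sy → [ y≢a , y≢b ] (only-ab y x~y Sy)

    ω-≥-neighbour : ∀ ℓ x a → S x ≡ true → S a ≡ true → Adj G x a → ω G S ℓ a ≤ ω G S (suc ℓ) x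
    ω-≥-neighbour ℓ x a Sx Sa x~a =
      subst₂ _≤_ (via-neighbour ℓ x a x~a Sa) (sym (ω-suc ℓ x Sx)) (sumFin-≥₁ n (via ℓ x) a)

    ω-≥-two-neighbours : ∀ ℓ x a b → S x ≡ true → S a ≡ true → S b ≡ true → Adj G x a → Adj G x b → b ≢ a →
                         ω G S ℓ a + ω G S ℓ b ≤ ω G S (suc ℓ) x
    ω-≥-two-neighbours ℓ x a b Sx Sa Sb x~a x~b b≢a =
      subst₂ _≤_ (cong₂ _+_ (via-neighbour ℓ x a x~a Sa) (via-neighbour ℓ x b x~b Sb)) (sym (ω-suc ℓ x Sx))
        (sumFin-≥₂ n (via ℓ x) a b b≢a)

  diff-+ : ∀ a b c d → + (a + b) - + (c + d) ≡ (+ a - + c) ℤ.+ (+ b - + d)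
  diff-+ a b c d rewrite ℤP.pos-+ a b | ℤP.pos-+ c d = regroup (+ a) (+ b) (+ c) (+ d)
    where
    regroup : ∀ (x y z w : ℤ) → (x ℤ.+ y) - (z ℤ.+ w) ≡ (x - z) ℤ.+ (y - w)
    regroup = solve-∀

  -- The shape of the inequality at p_k: adding ω(y) on the B-side only.
  diff-+-≤ : ∀ a l A c → a + l ≤ A → (+ a - + c) ℤ.+ + l ℤ.≤ + A - + c
  diff-+-≤ a l A c a+l≤A =
    subst (ℤ._≤ + A - + c) (trans (cong (_- + c) (ℤP.pos-+ a l)) (regroup (+ a) (+ l) (+ c)))
      (ℤP.+-monoˡ-≤ (ℤ.- + c) (ℤ.+≤+ a+l≤A))
    where
    regroup : ∀ (x y z : ℤ) → (x ℤ.+ y) - z ≡ (x - z) ℤ.+ y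
    regroup = solve-∀

  diff-≤ : ∀ A B L → A ≤ L → + A - + B ℤ.≤ + L
  diff-≤ A B L A≤L = ℤP.≤-trans (ℤP.i-j≤i (+ A) (+ B)) (ℤ.+≤+ A≤L)

  -- When k + 1 is even, no two consecutive indices are mirror images in 0 … k+1.
  odd-no-middle : ∀ m j → suc j + suc (suc j) ≢ suc (suc (2 * m))
  odd-no-middle m j eq = ℕP.even≢odd (suc j) m (ℕP.suc-injective (begin
      suc (2 * suc j)             ≡⟨ cong (λ t → suc (suc j + t)) (ℕP.+-identityʳ (suc j)) ⟩
      suc (suc j + suc j)         ≡⟨ sym (ℕP.+-suc (suc j) (suc j)) ⟩
      suc j + suc (suc j)         ≡⟨ eq ⟩
      suc (suc (2 * m))           ∎))
    where open ≡-Reasoning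

  module MirrorComparison (k : ℕ) (k-odd : ∃ λ m → k ≡ suc (2 * m)) (E : ℕ → ℕ → ℤ)
    (rec-start : ∀ ℓ → E (suc ℓ) 0 ≡ E ℓ 1)
    (rec-inner : ∀ ℓ j → suc j < k → E (suc ℓ) (suc j) ≡ E ℓ j ℤ.+ E ℓ (suc (suc j)))
    (rec-end : ∀ ℓ → E ℓ (k ∸ 1) ℤ.+ E ℓ (suc k) ℤ.≤ E (suc ℓ) k)
    (rec-out : ∀ ℓ → E ℓ k ℤ.≤ E (suc ℓ) (suc k))
    (init-path : ∀ j → j ≤ k → E 0 j ≡ + 0)
    (init-out : + 0 ℤ.≤ E 0 (suc k)) where

    open ℤP.≤-Reasoning

    1≤k : 1 ≤ k
    1≤k = subst (1 ≤_) (sym (proj₂ k-odd)) (s≤s z≤n)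

    neighbours-≤ : ∀ ℓ i → suc i ≤ k → E ℓ i ℤ.+ E ℓ (suc (suc i)) ℤ.≤ E (suc ℓ) (suc i)
    neighbours-≤ ℓ i i<k with ℕP.m≤n⇒m<n∨m≡n i<k
    ... | inj₁ i+1<k = ℤP.≤-reflexive (sym (rec-inner ℓ i i+1<k))
    ... | inj₂ i+1≡k = subst (λ t → E ℓ (t ∸ 1) ℤ.+ E ℓ (suc t) ℤ.≤ E (suc ℓ) t) (sym i+1≡k) (rec-end ℓ)

    -- At level 0 the left index is on the path (where E vanishes) and E is non-negative.
    level-zero : ∀ j i → j + i ≡ suc k → j ≤ i → E 0 j ℤ.≤ E 0 i
    level-zero j i eq j≤i = begin
        E 0 j    ≡⟨ init-path j j≤k ⟩
        + 0      ≤⟨ nonneg (ℕP.m≤n⇒m<n∨m≡n (subst (i ≤_) eq (ℕP.m≤n+m i j))) ⟩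
        E 0 i    ∎
      where
      j≤k : j ≤ k
      j≤k with ℕP.m≤n⇒m<n∨m≡n (subst (j ≤_) eq (ℕP.m≤m+n j i))
      ... | inj₁ (s≤s j≤k) = j≤k
      ... | inj₂ refl with ℕP.+-cancelˡ-≡ (suc k) i 0 (trans eq (sym (ℕP.+-identityʳ (suc k))))
      ...   | refl = ⊥-elim (ℕP.n≮0 j≤i)
      nonneg : i < suc k ⊎ i ≡ suc k → + 0 ℤ.≤ E 0 i
      nonneg (inj₁ (s≤s i≤k)) = ℤP.≤-reflexive (sym (init-path i i≤k))
      nonneg (inj₂ refl) = init-out

    mirror-≤ : ∀ ℓ j i → j + i ≡ suc k → j ≤ i → E ℓ j ℤ.≤ E ℓ i
    mirror-≤ zero j i eq j≤i = level-zero j i eq j≤i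
    mirror-≤ (suc ℓ) zero .(suc k) refl _ = begin
        E (suc ℓ) 0          ≡⟨ rec-start ℓ ⟩
        E ℓ 1                ≤⟨ mirror-≤ ℓ 1 k refl 1≤k ⟩
        E ℓ k                ≤⟨ rec-out ℓ ⟩
        E (suc ℓ) (suc k)    ∎
    mirror-≤ (suc ℓ) (suc j) (suc i) eq (s≤s j≤i) with j ℕP.≟ i
    ... | yes refl = ℤP.≤-refl
    ... | no j≢i = begin
        E (suc ℓ) (suc j)                    ≡⟨ rec-inner ℓ j j+1<k ⟩
        E ℓ j ℤ.+ E ℓ (suc (suc j))          ≤⟨ ℤP.+-mono-≤ outer inner ⟩
        E ℓ (suc (suc i)) ℤ.+ E ℓ i          ≡⟨ ℤP.+-comm (E ℓ (suc (suc i))) (E ℓ i) ⟩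
        E ℓ i ℤ.+ E ℓ (suc (suc i))          ≤⟨ neighbours-≤ ℓ i i+1≤k ⟩
        E (suc ℓ) (suc i)                    ∎
      where
      j<i : j < i
      j<i = ℕP.≤∧≢⇒< j≤i j≢i
      j+1<i : suc j < i
      j+1<i = ℕP.≤∧≢⇒< j<i (λ j+1≡i → odd-no-middle (proj₁ k-odd) j (trans (trans (cong (λ t → suc j + suc t) j+1≡i) eq) (cong suc (proj₂ k-odd))))
      i+1≤k : suc i ≤ k
      i+1≤k = subst (suc i ≤_) (ℕP.suc-injective eq) (ℕP.m≤n+m (suc i) j)
      j+1<k : suc j < k
      j+1<k = ℕP.≤-trans j+1<i (ℕP.≤-trans (ℕP.n≤1+n i) i+1≤k)
      outer : E ℓ j ℤ.≤ E ℓ (suc (suc i))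
      outer = mirror-≤ ℓ j (suc (suc i)) (trans (ℕP.+-suc j (suc i)) eq) (ℕP.≤-trans j≤i (ℕP.≤-trans (ℕP.n≤1+n i) (ℕP.n≤1+n (suc i))))
      inner : E ℓ (suc (suc j)) ℤ.≤ E ℓ i
      inner = mirror-≤ ℓ (suc (suc j)) i (trans (sym (ℕP.+-suc (suc j) i)) eq) j+1<i

  -- clamp k j is j as an element of Fin (suc k) when j ≤ k; it lets us write p_j for j : ℕ.
  clamp : (k j : ℕ) → Fin (suc k)
  clamp k zero = zero
  clamp zero (suc j) = zero
  clamp (suc k) (suc j) = suc (clamp k j)

  toℕ-clamp : ∀ k j → j ≤ k → toℕ (clamp k j) ≡ j
  toℕ-clamp k zero _ = refl
  toℕ-clamp (suc k) (suc j) (s≤s j≤k) = cong suc (toℕ-clamp k j j≤k)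

  clamp-toℕ : ∀ k (f : Fin (suc k)) → clamp k (toℕ f) ≡ f
  clamp-toℕ k zero = refl
  clamp-toℕ (suc k) (suc f) = cong suc (clamp-toℕ k f)

  InPathEdges-sym : ∀ {n} k (p : Fin (suc k) → Fin n) {u v} → InPathEdges k p u v → InPathEdges k p v u
  InPathEdges-sym k p (i , inj₁ ends) = i , inj₂ ends
  InPathEdges-sym k p (i , inj₂ ends) = i , inj₁ ends

  module PathInTree {n : ℕ} (T : Graph n) (acyclic : Acyclic T) (r : ℕ) (p : Fin (suc (suc r)) → Fin n)
    (path : IsPath T (suc r) p)
    (interior-deg : ∀ (i : Fin (suc r)) → suc (toℕ i) < suc r → deg T (p (suc i)) ≡ 2) where

    k : ℕ
    k = suc r

    E′ : Fin n → Fin n → Set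
    E′ = AdjMinus T k p

    pv : ℕ → Fin n
    pv j = p (clamp k j)

    p≡pv : ∀ f → p f ≡ pv (toℕ f)
    p≡pv f = cong p (sym (clamp-toℕ k f))

    pv-last : p (fromℕ k) ≡ pv k
    pv-last = trans (p≡pv (fromℕ k)) (cong pv (toℕ-fromℕ k))

    pv-injective : ∀ {i j} → i ≤ k → j ≤ k → pv i ≡ pv j → i ≡ j
    pv-injective {i} {j} i≤k j≤k eq =
      trans (sym (toℕ-clamp k i i≤k)) (trans (cong toℕ (proj₁ path eq)) (toℕ-clamp k j j≤k))

    p-inject : ∀ (i : Fin k) → p (inject₁ i) ≡ pv (toℕ i)
    p-inject i = trans (p≡pv (inject₁ i)) (cong pv (toℕ-inject₁ i))

    pv-adjacent : ∀ j → j < k → Adj T (pv j) (pv (suc j))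
    pv-adjacent j j<k = subst₂ (Adj T)
      (trans (p-inject i) (cong pv (toℕ-fromℕ< j<k)))
      (trans (p≡pv (suc i)) (cong (λ t → pv (suc t)) (toℕ-fromℕ< j<k)))
      (proj₂ path i)
      where i = fromℕ< j<k

    path-edge : ∀ j → j < k → InPathEdges k p (pv j) (pv (suc j))
    path-edge j j<k = i , inj₁ (trans (cong pv (sym (toℕ-fromℕ< j<k))) (sym (p-inject i)) ,
                                trans (cong (λ t → pv (suc t)) (sym (toℕ-fromℕ< j<k))) (sym (p≡pv (suc i))))
      where i = fromℕ< j<k

    path-edge-consecutive : ∀ {a b} → a ≤ k → b ≤ k → InPathEdges k p (pv a) (pv b) → b ≡ suc a ⊎ a ≡ suc b
    path-edge-consecutive a≤k b≤k (i , inj₁ (a≡ , b≡)) = inj₁ (trans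
      (pv-injective b≤k (toℕ<n i) (trans b≡ (p≡pv (suc i))))
      (cong suc (sym (pv-injective a≤k (ℕP.<⇒≤ (toℕ<n i)) (trans a≡ (p-inject i))))))
    path-edge-consecutive a≤k b≤k (i , inj₂ (b≡ , a≡)) = inj₂ (trans
      (pv-injective a≤k (toℕ<n i) (trans a≡ (p≡pv (suc i))))
      (cong suc (sym (pv-injective b≤k (ℕP.<⇒≤ (toℕ<n i)) (trans b≡ (p-inject i))))))

    interior-neighbours : ∀ j {y} → suc j < k → Adj T (pv (suc j)) y → y ≡ pv j ⊎ y ≡ pv (suc (suc j))
    interior-neighbours j {y} j+1<k x~y with y ≟ pv j | y ≟ pv (suc (suc j))
    ... | yes y≡ | _ = inj₁ y≡
    ... | no _ | yes y≡ = inj₂ y≡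
    ... | no y≢pj | no y≢pj+2 = ⊥-elim (ℕP.<-irrefl refl (subst (3 ≤_) degree≡2
          (deg-≥3 T (pv (suc j)) (pv j) (pv (suc (suc j))) y
            (Adj-sym T (pv-adjacent j j<k)) (pv-adjacent (suc j) j+1<k) x~y pj+2≢pj y≢pj y≢pj+2)))
      where
      j<k : j < k
      j<k = ℕP.<-trans (ℕP.n<1+n j) j+1<k
      pj+2≢pj : pv (suc (suc j)) ≢ pv j
      pj+2≢pj eq with pv-injective j+1<k (ℕP.<⇒≤ j<k) eq
      ... | ()
      degree≡2 : deg T (pv (suc j)) ≡ 2
      degree≡2 = trans (cong (deg T) (trans (cong (λ t → pv (suc t)) (sym (toℕ-fromℕ< j<k))) (sym (p≡pv (suc i)))))
        (interior-deg i (subst (λ t → suc t < k) (sym (toℕ-fromℕ< j<k)) j+1<k))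
        where i = fromℕ< j<k

    interior-isolated : ∀ j {x} → suc j < k → ¬ E′ x (pv (suc j))
    interior-isolated j j+1<k (x~pj+1 , not-path) with interior-neighbours j j+1<k (Adj-sym T x~pj+1)
    ... | inj₁ refl = not-path (path-edge j (ℕP.<-trans (ℕP.n<1+n j) j+1<k))
    ... | inj₂ refl = not-path (InPathEdges-sym k p (path-edge (suc j) j+1<k))

    segment : ℕ → ℕ → List (Fin n)
    segment a zero = pv a ∷ []
    segment a (suc d) = pv a ∷ segment (suc a) d

    segment-walk : ∀ a d → a + d ≡ k → WalkR (Adj T) (pv a) (pv k) (segment a d)
    segment-walk a zero eq = subst (λ t → WalkR (Adj T) (pv a) (pv t) (pv a ∷ [])) (trans (sym (ℕP.+-identityʳ a)) eq) (single (pv a))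
    segment-walk a (suc d) eq = step (pv-adjacent a (subst (a <_) eq (ℕP.m<m+n a (s≤s z≤n))))
      (segment-walk (suc a) d (trans (sym (ℕP.+-suc a d)) eq))

    segment-∈ : ∀ a d {z} → z ∈ segment a d → ∃ λ j → a ≤ j × j ≤ a + d × z ≡ pv j
    segment-∈ a zero (here refl) = a , ℕP.≤-refl , ℕP.m≤m+n a 0 , refl
    segment-∈ a (suc d) (here refl) = a , ℕP.≤-refl , ℕP.m≤m+n a (suc d) , refl
    segment-∈ a (suc d) (there z∈) with segment-∈ (suc a) d z∈
    ... | j , a<j , j≤ , z≡ = j , ℕP.<⇒≤ a<j , subst (j ≤_) (sym (ℕP.+-suc a d)) j≤ , z≡

    segment-length : ∀ a d → length (segment a d) ≡ suc d
    segment-length a zero = refl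
    segment-length a (suc d) = cong suc (segment-length (suc a) d)

    segment-unique : ∀ a d → a + d ≤ k → Unique (segment a d)
    segment-unique a zero _ = [] ∷ []
    segment-unique a (suc d) a+d≤k =
      All.tabulate fresh ∷ segment-unique (suc a) d (subst (_≤ k) (ℕP.+-suc a d) a+d≤k)
      where
      fresh : ∀ {z} → z ∈ segment (suc a) d → pv a ≢ z
      fresh z∈ pa≡z with segment-∈ (suc a) d z∈
      ... | j , a<j , j≤ , refl = ℕP.<-irrefl
        (pv-injective (ℕP.≤-trans (ℕP.m≤m+n a (suc d)) a+d≤k)
                      (ℕP.≤-trans (subst (j ≤_) (sym (ℕP.+-suc a d)) j≤) a+d≤k) pa≡z)
        a<j

    -- A walk p_k → w → … → p_0 in T − E(P), continued along p_1 … p_k, visits at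
    -- least three vertices: if it is the single edge p_k p_0, that edge is not in P, so k ≥ 2.
    closing-length : ∀ {w ws} → WalkR E′ w (pv 0) ws → E′ (pv k) w → 3 ≤ length ws + k
    closing-length (step _ q) _ with walk-starts q
    ... | _ , refl = s≤s (s≤s (ℕP.≤-trans (s≤s z≤n) (ℕP.m≤n+m k _)))
    closing-length (single _) (_ , not-path) = s≤s (s≤s (ℕP.n≢0⇒n>0 r≢0))
      where
      r≢0 : r ≢ 0
      r≢0 r≡0 = not-path (subst (λ x → InPathEdges k p x (pv 0)) (cong (λ t → pv (suc t)) (sym r≡0))
                                 (InPathEdges-sym k p (path-edge 0 (s≤s z≤n))))

    -- The use of acyclicity: T − E(P) has no simple walk from p_k to p_0,
    -- since it would close up with P into a cycle.
    no-simple-return : ∀ {u v ws} → WalkR E′ u v ws → Unique ws → u ≡ pv k → v ≡ pv 0 → ⊥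
    no-simple-return (single _) _ u≡ v≡ with pv-injective ℕP.≤-refl z≤n (trans (sym u≡) v≡)
    ... | ()
    no-simple-return (step {w = w} {vs = ws} e q) (pk∉ ∷ U) refl refl =
      acyclic (closed-walk⇒cycle T cycle-walk simple long (proj₁ e))
      where
      cycle-walk : WalkR (Adj T) w (pv k) (ws ++ segment 1 r)
      cycle-walk = walk-++ (walk-map proj₁ q) (step (pv-adjacent 0 (s≤s z≤n)) (segment-walk 1 r refl))
      disjoint : ∀ {z} → ¬ (z ∈ ws × z ∈ segment 1 r)
      disjoint (z∈q , z∈P) with segment-∈ 1 r z∈P
      ... | suc j , _ , j+1≤k , refl with ℕP.m≤n⇒m<n∨m≡n j+1≤k
      ...   | inj₂ refl = All.lookup pk∉ z∈q refl
      ...   | inj₁ j+1<k with walk-entered (step e q) (there z∈q)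
      ...     | inj₁ pj+1≡pk = All.lookup pk∉ z∈q (sym pj+1≡pk)
      ...     | inj₂ (_ , entering) = interior-isolated j j+1<k entering
      simple : Unique (ws ++ segment 1 r)
      simple = Unique.++⁺ U (segment-unique 1 r ℕP.≤-refl) disjoint
      long : 3 ≤ length (ws ++ segment 1 r)
      long rewrite length-++ ws {segment 1 r} | segment-length 1 r = closing-length q e

    no-return : ∀ {u v ws} → WalkR E′ u v ws → u ≡ pv k → v ≡ pv 0 → ⊥
    no-return W u≡ v≡ with loop-erase W
    ... | _ , W′ , U = no-simple-return W′ U u≡ v≡

    no-chord : 2 ≤ k → ¬ Adj T (pv k) (pv 0)
    no-chord 2≤k pk~p0 = no-return (step (pk~p0 , not-path) (single (pv 0))) refl refl
      where
      not-path : ¬ InPathEdges k p (pv k) (pv 0)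
      not-path pe with path-edge-consecutive ℕP.≤-refl z≤n pe
      ... | inj₂ k≡1 = ℕP.<-irrefl (sym k≡1) 2≤k

    module WithComponent (SB : Fin n → Bool)
      (SB⊆B : ∀ x → SB x ≡ true → InComponent T k p x)
      (B⊆SB : ∀ x → InComponent T k p x → SB x ≡ true)
      (SP : Fin n → Bool)
      (SP⊆P : ∀ x → SP x ≡ true → Σ (Fin (suc k)) (λ j → x ≡ p j))
      (P⊆SP : ∀ (j : Fin (suc k)) → SP (p j) ≡ true)
      (branch : ∃ λ x → InComponent T k p x × x ≢ p (fromℕ k)) where

      S : Fin n → Bool
      S x = SB x ∨ SP x

      SP⇒S : ∀ y → SP y ≡ true → S y ≡ true
      SP⇒S y y∈P rewrite y∈P = ∨-zeroʳ (SB y)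

      SP-pv : ∀ j → SP (pv j) ≡ true
      SP-pv j = P⊆SP (clamp k j)

      S-pv : ∀ j → S (pv j) ≡ true
      S-pv j = SP⇒S (pv j) (SP-pv j)

      SP-on-path : ∀ {y} → SP y ≡ true → ∃ λ j → j ≤ k × y ≡ pv j
      SP-on-path {y} y∈P with SP⊆P y y∈P
      ... | f , refl = toℕ f , ℕP.≤-pred (toℕ<n f) , p≡pv f

      off-path-edge : ∀ {y z} → SP y ≡ false → ¬ InPathEdges k p y z
      off-path-edge {y} y∉P (i , inj₁ (y≡ , _)) = false≢true (trans (sym y∉P) (trans (cong SP y≡) (P⊆SP _)))
      off-path-edge {y} y∉P (i , inj₂ (_ , y≡)) = false≢true (trans (sym y∉P) (trans (cong SP y≡) (P⊆SP _)))

      -- Among path vertices only p_1 is adjacent to p_0 (no chord, interior degree two).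
      start-neighbour-on-path : ∀ j → j ≤ k → Adj T (pv 0) (pv j) → pv j ≡ pv 1
      start-neighbour-on-path zero _ p0~p0 = ⊥-elim (Adj-irrefl T p0~p0)
      start-neighbour-on-path (suc zero) _ _ = refl
      start-neighbour-on-path (suc (suc j)) j+2≤k p0~pj+2 with ℕP.m≤n⇒m<n∨m≡n j+2≤k
      ... | inj₂ refl = ⊥-elim (no-chord (s≤s (s≤s z≤n)) (Adj-sym T p0~pj+2))
      ... | inj₁ j+2<k with interior-neighbours (suc j) j+2<k (Adj-sym T p0~pj+2)
      ...   | inj₁ p0≡pj+1 with pv-injective z≤n (ℕP.<⇒≤ (ℕP.<-trans (ℕP.n<1+n (suc j)) j+2<k)) p0≡pj+1
      ...     | ()
      start-neighbour-on-path (suc (suc j)) _ _ | inj₁ j+2<k | inj₂ p0≡pj+3 with pv-injective z≤n j+2<k p0≡pj+3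
      ...     | ()

      -- p_1 is the only neighbour of p_0 in B ∪ P: a neighbour in B would give a
      -- walk from p_k to p_0 in T − E(P).
      start-neighbour : ∀ y → Adj T (pv 0) y → S y ≡ true → y ≡ pv 1
      start-neighbour y p0~y y∈S with SP y in y∈P
      ... | true with SP-on-path y∈P
      ...   | j , j≤k , refl = start-neighbour-on-path j j≤k p0~y
      start-neighbour y p0~y y∈S | false with SB y in y∈B
      ... | true = ⊥-elim (no-return walk-back pv-last refl)
        where
        walk-back = walk-++ (proj₂ (SB⊆B y y∈B)) (step (Adj-sym T p0~y , off-path-edge y∈P) (single (pv 0)))
      start-neighbour y p0~y () | false | false

      end-neighbour-on-path : ∀ j → j ≤ k → Adj T (pv k) (pv j) → pv j ≡ pv r
      end-neighbour-on-path j j≤k pk~pj with j ℕP.≟ r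
      ... | yes refl = refl
      end-neighbour-on-path zero _ pk~p0 | no 0≢r =
        ⊥-elim (no-chord (s≤s (ℕP.n≢0⇒n>0 (λ r≡0 → 0≢r (sym r≡0)))) pk~p0)
      end-neighbour-on-path (suc j) j+1≤k pk~pj+1 | no j+1≢r with ℕP.m≤n⇒m<n∨m≡n j+1≤k
      ... | inj₂ refl = ⊥-elim (Adj-irrefl T pk~pj+1)
      ... | inj₁ j+1<k with interior-neighbours j j+1<k (Adj-sym T pk~pj+1)
      ...   | inj₁ pk≡pj = ⊥-elim (ℕP.<-irrefl (sym (pv-injective ℕP.≤-refl (ℕP.<⇒≤ j<k) pk≡pj)) j<k)
        where
        j<k : j < k
        j<k = ℕP.<-trans (ℕP.n<1+n j) j+1<k
      ...   | inj₂ pk≡pj+2 = ⊥-elim (j+1≢r (sym (ℕP.suc-injective (pv-injective ℕP.≤-refl j+1<k pk≡pj+2))))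

      end-neighbour-in-P : ∀ y → Adj T (pv k) y → SP y ≡ true → y ≡ pv r
      end-neighbour-in-P y pk~y y∈P with SP-on-path y∈P
      ... | j , j≤k , refl = end-neighbour-on-path j j≤k pk~y

      -- Since B ≠ {p_k}, p_k has a neighbour y ≠ p_{k−1} in B ∪ P: the first step
      -- of a walk in T − E(P) from p_k to another vertex of B.
      BranchNeighbour : Set
      BranchNeighbour = Σ (Fin n) λ y → Adj T (pv k) y × S y ≡ true × y ≢ pv r

      first-step : ∀ {u x vs} → WalkR E′ u x vs → u ≡ pv k → x ≢ pv k → BranchNeighbour
      first-step (single _) u≡pk x≢pk = ⊥-elim (x≢pk u≡pk)
      first-step (step {w = w} e _) refl _ = w , proj₁ e , cong (_∨ SP w) w∈B , w≢pr
        where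
        w∈B : SB w ≡ true
        w∈B = B⊆SB w (_ , subst (λ z → WalkR E′ z w (z ∷ w ∷ [])) (sym pv-last) (step e (single w)))
        w≢pr : w ≢ pv r
        w≢pr refl = proj₂ e (InPathEdges-sym k p (path-edge r ℕP.≤-refl))

      branch-neighbour : BranchNeighbour
      branch-neighbour = first-step (proj₂ (proj₁ (proj₂ branch))) pv-last
        (λ x≡pk → proj₂ (proj₂ branch) (trans x≡pk (sym pv-last)))

      open WalkCount

      y : Fin n
      y = proj₁ branch-neighbour

      pk~y : Adj T (pv k) y
      pk~y = proj₁ (proj₂ branch-neighbour)

      y∈S : S y ≡ true
      y∈S = proj₁ (proj₂ (proj₂ branch-neighbour))

      y≢pr : y ≢ pv r
      y≢pr = proj₂ (proj₂ (proj₂ branch-neighbour))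

      pk~pr : Adj T (pv k) (pv r)
      pk~pr = Adj-sym T (pv-adjacent r ℕP.≤-refl)

      Δ : ℕ → Fin n → ℤ
      Δ ℓ x = + ω T S ℓ x - + ω T SP ℓ x

      D : ℕ → ℕ → ℤ
      D ℓ j with j ≤? k
      ... | yes _ = Δ ℓ (pv j)
      ... | no _ = + ω T S ℓ y

      D-path : ∀ ℓ j → j ≤ k → D ℓ j ≡ Δ ℓ (pv j)
      D-path ℓ j j≤k with j ≤? k
      ... | yes _ = refl
      ... | no j≰k = ⊥-elim (j≰k j≤k)

      D-out : ∀ ℓ → D ℓ (suc k) ≡ + ω T S ℓ y
      D-out ℓ with suc k ≤? k
      ... | yes k+1≤k = ⊥-elim (ℕP.<-irrefl refl k+1≤k)
      ... | no _ = refl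

      -- Walks from p_0 continue at p_1, in T[B ∪ P] as well as in P.
      rec-start : ∀ ℓ → D (suc ℓ) 0 ≡ D ℓ 1
      rec-start ℓ = begin
          D (suc ℓ) 0          ≡⟨ D-path (suc ℓ) 0 z≤n ⟩
          Δ (suc ℓ) (pv 0)     ≡⟨ cong₂ (λ a b → + a - + b)
                                    (ω-one-neighbour T S ℓ (pv 0) (pv 1) (S-pv 0) (S-pv 1) p0~p1 start-neighbour)
                                    (ω-one-neighbour T SP ℓ (pv 0) (pv 1) (SP-pv 0) (SP-pv 1) p0~p1
                                      (λ x p0~x x∈P → start-neighbour x p0~x (SP⇒S x x∈P))) ⟩
          Δ ℓ (pv 1)           ≡⟨ sym (D-path ℓ 1 (s≤s z≤n)) ⟩
          D ℓ 1                ∎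
        where
        open ≡-Reasoning
        p0~p1 = pv-adjacent 0 (s≤s z≤n)

      -- Walks from an interior vertex continue at one of its two path neighbours.
      rec-inner : ∀ ℓ j → suc j < k → D (suc ℓ) (suc j) ≡ D ℓ j ℤ.+ D ℓ (suc (suc j))
      rec-inner ℓ j j+1<k = begin
          D (suc ℓ) (suc j)                          ≡⟨ D-path (suc ℓ) (suc j) (ℕP.<⇒≤ j+1<k) ⟩
          Δ (suc ℓ) (pv (suc j))                     ≡⟨ cong₂ (λ a b → + a - + b) (split S S-pv) (split SP SP-pv) ⟩
          + (ω T S ℓ (pv j) + ω T S ℓ (pv (suc (suc j))))
            - + (ω T SP ℓ (pv j) + ω T SP ℓ (pv (suc (suc j))))
                                                     ≡⟨ diff-+ (ω T S ℓ (pv j)) (ω T S ℓ (pv (suc (suc j)))) (ω T SP ℓ (pv j)) (ω T SP ℓ (pv (suc (suc j)))) ⟩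
          Δ ℓ (pv j) ℤ.+ Δ ℓ (pv (suc (suc j)))      ≡⟨ sym (cong₂ ℤ._+_ (D-path ℓ j (ℕP.<⇒≤ j<k)) (D-path ℓ (suc (suc j)) j+1<k)) ⟩
          D ℓ j ℤ.+ D ℓ (suc (suc j))                ∎
        where
        open ≡-Reasoning
        j<k : j < k
        j<k = ℕP.<-trans (ℕP.n<1+n j) j+1<k
        pj+2≢pj : pv (suc (suc j)) ≢ pv j
        pj+2≢pj eq with pv-injective j+1<k (ℕP.<⇒≤ j<k) eq
        ... | ()
        split : ∀ (X : Fin n → Bool) → (∀ i → X (pv i) ≡ true) →
                ω T X (suc ℓ) (pv (suc j)) ≡ ω T X ℓ (pv j) + ω T X ℓ (pv (suc (suc j)))
        split X X-pv = ω-two-neighbours T X ℓ (pv (suc j)) (pv j) (pv (suc (suc j))) (X-pv _) (X-pv _) (X-pv _)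
          (Adj-sym T (pv-adjacent j j<k)) (pv-adjacent (suc j) j+1<k) pj+2≢pj
          (λ z pj+1~z _ → interior-neighbours j j+1<k pj+1~z)

      -- From p_k, walks in P continue at p_{k−1}; in T[B ∪ P] they may also continue at y.
      rec-end : ∀ ℓ → D ℓ r ℤ.+ D ℓ (suc k) ℤ.≤ D (suc ℓ) k
      rec-end ℓ rewrite D-path ℓ r (ℕP.n≤1+n r) | D-out ℓ | D-path (suc ℓ) k ℕP.≤-refl
        | ω-one-neighbour T SP ℓ (pv k) (pv r) (SP-pv k) (SP-pv r) pk~pr end-neighbour-in-P =
        diff-+-≤ (ω T S ℓ (pv r)) (ω T S ℓ y) (ω T S (suc ℓ) (pv k)) (ω T SP ℓ (pv r))
          (ω-≥-two-neighbours T S ℓ (pv k) (pv r) y (S-pv k) (S-pv r) y∈S pk~pr pk~y y≢pr)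

      -- Walks from y may continue at p_k.
      rec-out : ∀ ℓ → D ℓ k ℤ.≤ D (suc ℓ) (suc k)
      rec-out ℓ rewrite D-path ℓ k ℕP.≤-refl | D-out (suc ℓ) =
        diff-≤ (ω T S ℓ (pv k)) (ω T SP ℓ (pv k)) (ω T S (suc ℓ) y) (ω-≥-neighbour T S ℓ y (pv k) y∈S (S-pv k) (Adj-sym T pk~y))

      init-path : ∀ j → j ≤ k → D 0 j ≡ + 0
      init-path j j≤k rewrite D-path 0 j j≤k | ω-zero T S (pv j) (S-pv j) | ω-zero T SP (pv j) (SP-pv j) = refl

      init-out : + 0 ℤ.≤ D 0 (suc k)
      init-out rewrite D-out 0 = ℤ.+≤+ z≤n

      comparison : (∃ λ m → k ≡ suc (2 * m)) → ∀ ℓ → Δ (suc ℓ) (p zero) ℤ.≤ Δ ℓ (p (fromℕ k))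
      comparison k-odd ℓ = begin
          Δ (suc ℓ) (p zero)     ≡⟨ sym (D-path (suc ℓ) 0 z≤n) ⟩
          D (suc ℓ) 0            ≡⟨ rec-start ℓ ⟩
          D ℓ 1                  ≤⟨ mirror-≤ ℓ 1 k refl (s≤s z≤n) ⟩
          D ℓ k                  ≡⟨ D-path ℓ k ℕP.≤-refl ⟩
          Δ ℓ (pv k)             ≡⟨ cong (Δ ℓ) (sym pv-last) ⟩
          Δ ℓ (p (fromℕ k))      ∎
        where
        open MirrorComparison k k-odd D rec-start rec-inner rec-end rec-out init-path init-out
        open ℤP.≤-Reasoning

open import Defs
open import Data.Nat using (ℕ; suc; _≥_; _*_; _+_)
open import Data.Integer using (+_; _-_; _≤_)
open import Data.Bool using (Bool; true)
open import Data.Fin using (Fin; suc; fromℕ; zero)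
open import Data.Product using (Σ; _×_; ∃; _,_; proj₂)
open import Relation.Binary.PropositionalEquality using (_≡_; _≢_; refl)
open Development using (module PathInTree)

lemma2 : ∀ {n : ℕ} (T : Graph n) → IsTree T →
  (k : ℕ) (p : Fin (suc k) → Fin n) → IsPath T k p →
  (∀ (i : Fin k) → suc (Data.Fin.toℕ i) Data.Nat.< k → deg T (p (suc i)) ≡ 2) →
  (SB : Fin n → Bool) →
  (∀ x → SB x ≡ true → InComponent T k p x) →
  (∀ x → InComponent T k p x → SB x ≡ true) →
  (SP : Fin n → Bool) →
  (∀ x → SP x ≡ true → Σ (Fin (suc k)) (λ j → x ≡ p j)) →
  (∀ (j : Fin (suc k)) → SP (p j) ≡ true) →
  (∃ λ x → InComponent T k p x × x ≢ p (fromℕ k)) →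
  (∃ λ m → k ≡ 1 + 2 * m) →
  (ℓ : ℕ) → ℓ ≥ 1 →
  (+ ω T (λ x → SB x Data.Bool.∨ SP x) ℓ (p zero)) - (+ ω T SP ℓ (p zero))
    ≤ (+ ω T (λ x → SB x Data.Bool.∨ SP x) (ℓ Data.Nat.∸ 1) (p (fromℕ k)))
      - (+ ω T SP (ℓ Data.Nat.∸ 1) (p (fromℕ k)))
lemma2 T tree .(1 + 2 * m) p path interior-deg SB SB⊆B B⊆SB SP SP⊆P P⊆SP branch (m , refl) (suc ℓ) _ =
  comparison (m , refl) ℓ
  where
  open PathInTree T (proj₂ tree) (2 * m) p path interior-deg
  open WithComponent SB SB⊆B B⊆SB SP SP⊆P P⊆SP branch
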